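{- Let $t\ge 0$ and let $H$ be an $F_5^{t}$-free $3$-graph on vertex set $[n]$. For every pair of distinct vertices $x,x'\in[n]$ with $d(x,x')\ge t+1$ and all disjoint sets $S,T\subseteq[n]$, $$d_{S,T}(x)+d_{S,T}(x')\le |S||T|+(t+3)n\quad\text{and}\quad d_{S,S}(x)+d_{S,S}(x')\le \tfrac12|S|^2+(t+4)n.$$
   Context: A $3$-graph is a $3$-uniform hypergraph. For an integer $t\ge 0$, $F_5^{t}$ is the $3$-graph on vertex set $\{1,\dots,5+t\}$ with hyperedges $\{1,2,3\},\{1,2,4\}$ and $\{3,4,k\}$ for $5\le k\le 5+t$. For vertices $x,y$, $d(x,y)$ is the number of vertices $z$ with $\{x,y,z\}\in H$. For a vertex $x$ and sets $S,T\subseteq[n]$, $d_{S,T}(x)$ is the number of (unordered) pairs $\{y,z\}$ with $y\in S$, $z\in T$ and $\{x,y,z\}\in H$ (so $d_{S,S}(x)$ counts pairs $\{y,z\}\subseteq S$ with $\{x,y,z\}\in H$). -}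

module Defs where

open import Data.Nat using (ℕ; zero; suc; _+_; _*_; _<_)
open import Data.Nat.Properties using (_<?_)
open import Data.Bool using (Bool; true; false; _∧_; _∨_; if_then_else_)
open import Data.Fin using (Fin; toℕ; #_; _↑ʳ_)
open import Data.Fin.Subset using (Subset; _∈_; _∉_)
open import Data.Vec using (lookup)
open import Data.List using (List; map; allFin)
open import Data.Nat.ListAction using (sum)
open import Relation.Binary.PropositionalEquality using (_≡_; _≢_)
open import Relation.Nullary.Decidable using (⌊_⌋)
open import Function.Definitions using (Injective)

-- The predicate is symmetric and only true on triples of distinct vertices,
-- so it encodes exactly a set of 3-element subsets of Fin n.
record ThreeGraph (n : ℕ) : Set where
  field
    edge    : Fin n → Fin n → Fin n → Bool
    sym₁₂   : ∀ x y z → edge x y z ≡ edge y x z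
    sym₂₃   : ∀ x y z → edge x y z ≡ edge x z y
    irrefl  : ∀ x z → edge x x z ≡ false
open ThreeGraph public

Edge : ∀ {n} → ThreeGraph n → Fin n → Fin n → Fin n → Set
Edge H x y z = edge H x y z ≡ true

-- A copy of F_5^t in H: an injective map of the vertex set of F_5^t
-- ({1,...,5+t}, here Fin (5+t) with i ↦ i+1) into [n] carrying every edge
-- {1,2,3},{1,2,4},{3,4,k} (5 ≤ k ≤ 5+t) to an edge of H.
record CopyOfF5 (t : ℕ) {n : ℕ} (H : ThreeGraph n) : Set where
  field
    φ     : Fin (5 + t) → Fin n
    inj   : Injective _≡_ _≡_ φ
    e123  : Edge H (φ (# 0)) (φ (# 1)) (φ (# 2))
    e124  : Edge H (φ (# 0)) (φ (# 1)) (φ (# 3))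
    e34k  : ∀ (k : Fin (suc t)) → Edge H (φ (# 2)) (φ (# 3)) (φ (4 ↑ʳ k))

F5-free : (t : ℕ) → ∀ {n} → ThreeGraph n → Set
F5-free t H = CopyOfF5 t H → Data.Empty.⊥
  where import Data.Empty

count : ∀ {n} → (Fin n → Bool) → ℕ
count {n} p = sum (map (λ i → if p i then 1 else 0) (allFin n))

codeg : ∀ {n} → ThreeGraph n → Fin n → Fin n → ℕ
codeg H x y = count (λ z → edge H x y z)

-- d_{S,T}(x) = number of unordered pairs {y,z} with y ∈ S, z ∈ T and
-- {x,y,z} ∈ H.  Unordered pairs are enumerated as y < z (as naturals).
dST : ∀ {n} → ThreeGraph n → Subset n → Subset n → Fin n → ℕ
dST {n} H S T x =
  sum (map (λ y → count {n} (λ z →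
    ⌊ toℕ y <? toℕ z ⌋
    ∧ ((lookup S y ∧ lookup T z) ∨ (lookup S z ∧ lookup T y))
    ∧ edge H x y z)) (allFin n))

Disjoint : ∀ {n} → Subset n → Subset n → Set
Disjoint S T = ∀ v → v ∈ S → v ∉ T

{-# OPTIONS --safe #-}
-- Let N = {w : xx′w ∈ H}, so |N| = d(x,x′) ≥ t + 1.  If {x,y,z} and {x′,y,z} are both
-- edges, then N has at most t elements outside {y,z}: otherwise y, z, x, x′ and t + 1 of
-- them span a copy of F_5^t.  So as soon as such a common pair {y,z} exists, |N| ≤ t + 2
-- and every common pair meets N; hence there are at most n|N| ≤ (t + 2)n common pairs.
-- A pair counted by both d_{S,T}(x) and d_{S,T}(x′) is common, so the sum of the two
-- degrees exceeds the number of pairs meeting S and T by at most (t + 2)n.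
module Submission where

open import Defs
open import Data.Bool using (Bool; true; false; T; not; _∧_; _∨_; if_then_else_)
open import Data.Bool.Properties using (T-∧; T-≡; ∧-comm; ∨-idem)
open import Data.Empty using (⊥-elim)
open import Data.Fin using (Fin; zero; suc; toℕ)
open import Data.Fin.Properties using (_≟_; suc-injective; <⇒≢)
open import Data.Fin.Subset using (Subset; ∣_∣)
open import Data.List using (map; tabulate; allFin)
open import Data.List.Properties using (map-tabulate)
import Data.Nat.ListAction as List
open import Data.Nat using (ℕ; zero; suc; _+_; _*_; _^_; _≤_; _<_; z≤n; s≤s)
open import Data.Nat.Properties
  using ( _<?_; _≤?_; ≤-refl; ≤-reflexive; ≤-trans; ≤-pred; <-asym; ≰⇒>; m≤m+n
        ; +-mono-≤; +-monoʳ-≤; +-cancelˡ-≤; +-cancelʳ-≤; *-monoˡ-≤; *-monoʳ-≤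
        ; +-identityʳ; *-identityʳ; *-identityˡ; *-zeroʳ; *-comm; *-distribˡ-+; *-distribʳ-+
        ; +-*-semiring; module ≤-Reasoning )
open import Algebra.Properties.Semiring.Sum +-*-semiring
  using (sum; sum-syntax; sum-cong-≗; sum-replicate-zero; ∑-distrib-+; ∑-comm; *-distribˡ-sum; *-distribʳ-sum)
open import Data.Product using (_×_; _,_; Σ-syntax; proj₁; proj₂)
open import Data.Vec as Vec using (lookup)
open import Data.Vec.Functional using (_∷_)
open import Function using (_∘_; Equivalence)
open import Function.Definitions using (Injective)
open import Relation.Binary.PropositionalEquality using (_≡_; _≢_; refl; sym; trans; cong; cong₂; subst; ≢-sym)
open import Relation.Nullary using (yes; no)
open import Relation.Nullary.Decidable using (⌊_⌋; ⌊⌋-map′; toWitnessFalse)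

𝟙 : Bool → ℕ
𝟙 b = if b then 1 else 0

𝟙≤1 : ∀ b → 𝟙 b ≤ 1
𝟙≤1 false = z≤n
𝟙≤1 true  = ≤-refl

𝟙-≤ : ∀ {b m} → (T b → 1 ≤ m) → 𝟙 b ≤ m
𝟙-≤ {false} _ = z≤n
𝟙-≤ {true}  h = h _

𝟙-∧ : ∀ a b → 𝟙 (a ∧ b) ≡ 𝟙 a * 𝟙 b
𝟙-∧ false b = refl
𝟙-∧ true  b = sym (+-identityʳ (𝟙 b))

𝟙-∨-≤ : ∀ a b → 𝟙 (a ∨ b) ≤ 𝟙 a + 𝟙 b
𝟙-∨-≤ false b = ≤-refl
𝟙-∨-≤ true  b = s≤s z≤n

𝟙-∧-+-≤ : ∀ c a b → 𝟙 (c ∧ a) + 𝟙 (c ∧ b) ≤ 𝟙 c + 𝟙 (a ∧ b)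
𝟙-∧-+-≤ false a     b = z≤n
𝟙-∧-+-≤ true  false b = 𝟙≤1 b
𝟙-∧-+-≤ true  true  b = ≤-refl

𝟙-split : ∀ b p q → 𝟙 b ≤ 𝟙 (b ∧ (not p ∧ not q)) + (𝟙 (p ∧ b) + 𝟙 (q ∧ b))
𝟙-split false p     q     = z≤n
𝟙-split true  true  q     = s≤s z≤n
𝟙-split true  false true  = s≤s z≤n
𝟙-split true  false false = s≤s z≤n

𝟙-<?-exclusive : ∀ a b → 𝟙 ⌊ a <? b ⌋ + 𝟙 ⌊ b <? a ⌋ ≤ 1
𝟙-<?-exclusive a b with a <? b | b <? a
... | yes a<b | yes b<a = ⊥-elim (<-asym a<b b<a)
... | yes _   | no _    = ≤-refl
... | no _    | yes _   = ≤-refl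
... | no _    | no _    = z≤n

sum-mono-≤ : ∀ {n} {f g : Fin n → ℕ} → (∀ i → f i ≤ g i) → sum f ≤ sum g
sum-mono-≤ {zero}  h = z≤n
sum-mono-≤ {suc n} h = +-mono-≤ (h zero) (sum-mono-≤ (h ∘ suc))

sum-const : ∀ n c → ∑[ i < n ] c ≡ n * c
sum-const zero    c = refl
sum-const (suc n) c = cong (c +_) (sum-const n c)

sum-𝟙-at : ∀ {n} (y : Fin n) (p : Fin n → Bool) → ∑[ w < n ] 𝟙 (⌊ w ≟ y ⌋ ∧ p w) ≡ 𝟙 (p y)
sum-𝟙-at {suc n} zero    p = trans (cong (𝟙 (p zero) +_) (sum-replicate-zero n)) (+-identityʳ _)
-- ⌊ suc w ≟ suc y ⌋ does not reduce to ⌊ w ≟ y ⌋.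
sum-𝟙-at {suc n} (suc y) p = trans
  (sum-cong-≗ {n} (λ w → cong (λ b → 𝟙 (b ∧ p (suc w))) (⌊⌋-map′ (cong suc) suc-injective (w ≟ y))))
  (sum-𝟙-at y (p ∘ suc))

∑₂-distrib-+ : ∀ {m n} (f g : Fin m → Fin n → ℕ) →
  ∑[ y < m ] ∑[ z < n ] (f y z + g y z) ≡ ∑[ y < m ] ∑[ z < n ] f y z + ∑[ y < m ] ∑[ z < n ] g y z
∑₂-distrib-+ {m} {n} f g = trans (sum-cong-≗ {m} (λ y → ∑-distrib-+ (f y) (g y)))
  (∑-distrib-+ (λ y → ∑[ z < n ] f y z) (λ y → ∑[ z < n ] g y z))

∑₂-cong : ∀ {m n} {f g : Fin m → Fin n → ℕ} → (∀ y z → f y z ≡ g y z) →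
  ∑[ y < m ] ∑[ z < n ] f y z ≡ ∑[ y < m ] ∑[ z < n ] g y z
∑₂-cong {m} {n} h = sum-cong-≗ {m} (λ y → sum-cong-≗ {n} (h y))

∑₂-mono-≤ : ∀ {m n} {f g : Fin m → Fin n → ℕ} → (∀ y z → f y z ≤ g y z) →
  ∑[ y < m ] ∑[ z < n ] f y z ≤ ∑[ y < m ] ∑[ z < n ] g y z
∑₂-mono-≤ h = sum-mono-≤ (λ y → sum-mono-≤ (h y))

sum-*-sum : ∀ {m n} (f : Fin m → ℕ) (g : Fin n → ℕ) → sum f * sum g ≡ ∑[ y < m ] ∑[ z < n ] (f y * g z)
sum-*-sum f g = trans (*-distribʳ-sum (sum g) f) (sum-cong-≗ (λ y → *-distribˡ-sum (f y) g))

listSum-allFin : ∀ {n} (f : Fin n → ℕ) → List.sum (map f (allFin n)) ≡ sum f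
listSum-allFin f = trans (cong List.sum (map-tabulate (λ i → i) f)) (listSum-tabulate f)
  where
  listSum-tabulate : ∀ {n} (g : Fin n → ℕ) → List.sum (tabulate g) ≡ sum g
  listSum-tabulate {zero}  g = refl
  listSum-tabulate {suc n} g = cong (g zero +_) (listSum-tabulate (g ∘ suc))

count₂≡∑₂ : ∀ {n} (p : Fin n → Fin n → Bool) →
  List.sum (map (λ y → count (p y)) (allFin n)) ≡ ∑[ y < n ] ∑[ z < n ] 𝟙 (p y z)
count₂≡∑₂ {n} p = trans (listSum-allFin (λ y → count (p y)))
  (sum-cong-≗ {n} (λ y → listSum-allFin (λ z → 𝟙 (p y z))))

∣∣≡sum : ∀ {n} (S : Subset n) → ∣ S ∣ ≡ ∑[ i < n ] 𝟙 (lookup S i)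
∣∣≡sum Vec.[]            = refl
∣∣≡sum (true  Vec.∷ S) = cong suc (∣∣≡sum S)
∣∣≡sum (false Vec.∷ S) = ∣∣≡sum S

∣∣*∣∣≡∑₂ : ∀ {n} (S T : Subset n) →
  ∣ S ∣ * ∣ T ∣ ≡ ∑[ y < n ] ∑[ z < n ] 𝟙 (lookup S y ∧ lookup T z)
∣∣*∣∣≡∑₂ S T = trans (cong₂ _*_ (∣∣≡sum S) (∣∣≡sum T))
  (trans (sum-*-sum (λ y → 𝟙 (lookup S y)) (λ z → 𝟙 (lookup T z)))
    (∑₂-cong (λ y z → sym (𝟙-∧ (lookup S y) (lookup T z)))))

𝟙[_<_] : ∀ {n} → Fin n → Fin n → ℕ
𝟙[ y < z ] = 𝟙 ⌊ toℕ y <? toℕ z ⌋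

pairSum : ∀ {n} → (Fin n → Fin n → ℕ) → ℕ
pairSum {n} w = ∑[ y < n ] ∑[ z < n ] (𝟙[ y < z ] * w y z)

pairSum-mono : ∀ {n} {w w′ : Fin n → Fin n → ℕ} →
  (∀ {y z} → toℕ y < toℕ z → w y z ≤ w′ y z) → pairSum w ≤ pairSum w′
pairSum-mono {w = w} {w′} h = ∑₂-mono-≤ guarded
  where
  guarded : ∀ y z → 𝟙 ⌊ toℕ y <? toℕ z ⌋ * w y z ≤ 𝟙 ⌊ toℕ y <? toℕ z ⌋ * w′ y z
  guarded y z with toℕ y <? toℕ z
  ... | yes y<z = *-monoʳ-≤ 1 (h y<z)
  ... | no _    = z≤n

pairSum-+ : ∀ {n} (w w′ : Fin n → Fin n → ℕ) →
  pairSum (λ y z → w y z + w′ y z) ≡ pairSum w + pairSum w′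
pairSum-+ w w′ = trans
  (∑₂-cong (λ y z → *-distribˡ-+ (𝟙[ y < z ]) (w y z) (w′ y z)))
  (∑₂-distrib-+ (λ y z → 𝟙[ y < z ] * w y z) (λ y z → 𝟙[ y < z ] * w′ y z))

pairSum-zero : ∀ {n} → pairSum {n} (λ _ _ → 0) ≡ 0
pairSum-zero {n} = trans
  (sum-cong-≗ {n} (λ y → trans (sum-cong-≗ {n} (λ z → *-zeroʳ (𝟙[ y < z ]))) (sum-replicate-zero n)))
  (sum-replicate-zero n)

pairSum-symmetrised : ∀ {n} (w : Fin n → Fin n → ℕ) →
  pairSum (λ y z → w y z + w z y) ≤ ∑[ y < n ] ∑[ z < n ] w y z
pairSum-symmetrised {n} w = begin
  pairSum (λ y z → w y z + w z y)
    ≡⟨ pairSum-+ w (λ y z → w z y) ⟩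
  pairSum w + pairSum (λ y z → w z y)
    ≡⟨ cong (pairSum w +_) (∑-comm (λ y z → 𝟙[ y < z ] * w z y)) ⟩
  pairSum w + ∑[ y < n ] ∑[ z < n ] (𝟙[ z < y ] * w y z)
    ≡⟨ ∑₂-distrib-+ (λ y z → 𝟙[ y < z ] * w y z) (λ y z → 𝟙[ z < y ] * w y z) ⟨
  ∑[ y < n ] ∑[ z < n ] (𝟙[ y < z ] * w y z + 𝟙[ z < y ] * w y z)
    ≡⟨ ∑₂-cong (λ y z → sym (*-distribʳ-+ (w y z) (𝟙[ y < z ]) _)) ⟩
  ∑[ y < n ] ∑[ z < n ] ((𝟙[ y < z ] + 𝟙[ z < y ]) * w y z)
    ≤⟨ ∑₂-mono-≤ (λ y z → ≤-trans (*-monoˡ-≤ (w y z) (𝟙-<?-exclusive (toℕ y) (toℕ z)))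
                                   (≤-reflexive (*-identityˡ (w y z)))) ⟩
  ∑[ y < n ] ∑[ z < n ] w y z ∎
  where open ≤-Reasoning

∷-injective : ∀ {m n} {a : Fin n} {f : Fin m → Fin n} →
  Injective _≡_ _≡_ f → (∀ i → f i ≢ a) → Injective _≡_ _≡_ (a ∷ f)
∷-injective f-inj a∉f {zero}  {zero}  _     = refl
∷-injective f-inj a∉f {zero}  {suc j} a≡fj  = ⊥-elim (a∉f j (sym a≡fj))
∷-injective f-inj a∉f {suc i} {zero}  fi≡a  = ⊥-elim (a∉f i fi≡a)
∷-injective f-inj a∉f {suc i} {suc j} fi≡fj = cong suc (f-inj fi≡fj)

∷-avoids : ∀ {m n} {a b : Fin n} {f : Fin m → Fin n} →
  a ≢ b → (∀ i → f i ≢ b) → ∀ i → (a ∷ f) i ≢ b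
∷-avoids a≢b f≢b zero    = a≢b
∷-avoids a≢b f≢b (suc i) = f≢b i

injection-from-count : ∀ {n m} (p : Fin n → Bool) → m ≤ ∑[ i < n ] 𝟙 (p i) →
  Σ[ f ∈ (Fin m → Fin n) ] Injective _≡_ _≡_ f × (∀ k → T (p (f k)))
injection-from-count {m = zero} p _ = (λ ()) , (λ { {()} }) , (λ ())
injection-from-count {zero} {suc m} p ()
injection-from-count {suc n} {suc m} p m<count with p zero in p₀
... | true with injection-from-count (p ∘ suc) (≤-pred m<count)
...   | g , g-inj , g-p = zero ∷ (suc ∘ g) , ∷-injective (g-inj ∘ suc-injective) (λ i ()) , p-holds
  where
  p-holds : ∀ k → T (p ((zero ∷ (suc ∘ g)) k))
  p-holds zero    = subst T (sym p₀) _
  p-holds (suc k) = g-p k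
injection-from-count {suc n} {suc m} p m<count | false with injection-from-count (p ∘ suc) m<count
... | g , g-inj , g-p = suc ∘ g , g-inj ∘ suc-injective , g-p

module _ {n} (H : ThreeGraph n) where

  edge-rotate : ∀ {a b c} → Edge H a b c → Edge H b c a
  edge-rotate {a} {b} {c} abc = trans (sym₂₃ H b c a) (trans (sym₁₂ H b a c) abc)

  edge-≢₁₂ : ∀ {a b c} → Edge H a b c → a ≢ b
  edge-≢₁₂ {a} {c = c} aac refl with trans (sym (irrefl H a c)) aac
  ... | ()

  edge-≢₂₃ : ∀ {a b c} → Edge H a b c → b ≢ c
  edge-≢₂₃ abc = edge-≢₁₂ (edge-rotate abc)

  edge-≢₁₃ : ∀ {a b c} → Edge H a b c → a ≢ c
  edge-≢₁₃ abc = ≢-sym (edge-≢₂₃ (edge-rotate abc))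

across : ∀ {n} → Subset n → Subset n → Fin n → Fin n → Bool
across S T y z = (lookup S y ∧ lookup T z) ∨ (lookup S z ∧ lookup T y)

dST≡pairSum : ∀ {n} (H : ThreeGraph n) S T v →
  dST H S T v ≡ pairSum (λ y z → 𝟙 (across S T y z ∧ edge H v y z))
dST≡pairSum H S T v = trans
  (count₂≡∑₂ (λ y z → ⌊ toℕ y <? toℕ z ⌋ ∧ (across S T y z ∧ edge H v y z)))
  (∑₂-cong (λ y z → 𝟙-∧ ⌊ toℕ y <? toℕ z ⌋ (across S T y z ∧ edge H v y z)))

pairSum-across-≤ : ∀ {n} (S T : Subset n) → pairSum (λ y z → 𝟙 (across S T y z)) ≤ ∣ S ∣ * ∣ T ∣
pairSum-across-≤ S T = begin
  pairSum (λ y z → 𝟙 (across S T y z))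
    ≤⟨ pairSum-mono (λ {y} {z} _ → 𝟙-∨-≤ (lookup S y ∧ lookup T z) (lookup S z ∧ lookup T y)) ⟩
  pairSum (λ y z → 𝟙 (lookup S y ∧ lookup T z) + 𝟙 (lookup S z ∧ lookup T y))
    ≤⟨ pairSum-symmetrised (λ y z → 𝟙 (lookup S y ∧ lookup T z)) ⟩
  ∑[ y < _ ] ∑[ z < _ ] 𝟙 (lookup S y ∧ lookup T z)
    ≡⟨ ∣∣*∣∣≡∑₂ S T ⟨
  ∣ S ∣ * ∣ T ∣ ∎
  where open ≤-Reasoning

pairSum-across-self-≤ : ∀ {n} (S : Subset n) → 2 * pairSum (λ y z → 𝟙 (across S S y z)) ≤ ∣ S ∣ ^ 2
pairSum-across-self-≤ S = begin
  2 * P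
    ≡⟨ cong (P +_) (+-identityʳ P) ⟩
  P + P
    ≡⟨ pairSum-+ (λ y z → 𝟙 (across S S y z)) (λ y z → 𝟙 (across S S y z)) ⟨
  pairSum (λ y z → 𝟙 (across S S y z) + 𝟙 (across S S y z))
    ≡⟨ ∑₂-cong (λ y z → cong (𝟙[ y < z ] *_) (cong₂ _+_
         (cong 𝟙 (across-self y z)) (cong 𝟙 (trans (across-self y z) (∧-comm (lookup S y) (lookup S z)))))) ⟩
  pairSum (λ y z → 𝟙 (lookup S y ∧ lookup S z) + 𝟙 (lookup S z ∧ lookup S y))
    ≤⟨ pairSum-symmetrised (λ y z → 𝟙 (lookup S y ∧ lookup S z)) ⟩
  ∑[ y < _ ] ∑[ z < _ ] 𝟙 (lookup S y ∧ lookup S z)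
    ≡⟨ ∣∣*∣∣≡∑₂ S S ⟨
  ∣ S ∣ * ∣ S ∣
    ≡⟨ cong (∣ S ∣ *_) (*-identityʳ ∣ S ∣) ⟨
  ∣ S ∣ ^ 2 ∎
  where
  open ≤-Reasoning
  P : ℕ
  P = pairSum (λ y z → 𝟙 (across S S y z))
  across-self : ∀ y z → across S S y z ≡ (lookup S y ∧ lookup S z)
  across-self y z = trans (cong ((lookup S y ∧ lookup S z) ∨_) (∧-comm (lookup S z) (lookup S y))) (∨-idem _)

module JointNeighbourhood {t n} (H : ThreeGraph n) (H-free : F5-free t H)
                          {x x′ : Fin n} (x≢x′ : x ≢ x′) where

  N : Fin n → Bool
  N = edge H x x′

  common : Fin n → Fin n → Bool
  common y z = edge H x y z ∧ edge H x′ y z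

  N-avoiding : Fin n → Fin n → Fin n → Bool
  N-avoiding y z w = N w ∧ (not ⌊ w ≟ y ⌋ ∧ not ⌊ w ≟ z ⌋)

  codeg≤N-avoiding : ∀ y z → codeg H x x′ ≤ ∑[ w < n ] 𝟙 (N-avoiding y z w) + (𝟙 (N y) + 𝟙 (N z))
  codeg≤N-avoiding y z = begin
    codeg H x x′
      ≡⟨ listSum-allFin (λ w → 𝟙 (N w)) ⟩
    ∑[ w < n ] 𝟙 (N w)
      ≤⟨ sum-mono-≤ (λ w → 𝟙-split (N w) ⌊ w ≟ y ⌋ ⌊ w ≟ z ⌋) ⟩
    ∑[ w < n ] (𝟙 (N-avoiding y z w) + (𝟙 (⌊ w ≟ y ⌋ ∧ N w) + 𝟙 (⌊ w ≟ z ⌋ ∧ N w)))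
      ≡⟨ ∑-distrib-+ (λ w → 𝟙 (N-avoiding y z w)) _ ⟩
    ∑[ w < n ] 𝟙 (N-avoiding y z w) + ∑[ w < n ] (𝟙 (⌊ w ≟ y ⌋ ∧ N w) + 𝟙 (⌊ w ≟ z ⌋ ∧ N w))
      ≡⟨ cong (∑[ w < n ] 𝟙 (N-avoiding y z w) +_)
           (trans (∑-distrib-+ (λ w → 𝟙 (⌊ w ≟ y ⌋ ∧ N w)) _)
                  (cong₂ _+_ (sum-𝟙-at y N) (sum-𝟙-at z N))) ⟩
    ∑[ w < n ] 𝟙 (N-avoiding y z w) + (𝟙 (N y) + 𝟙 (N z)) ∎
    where open ≤-Reasoning

  N-avoiding-spec : ∀ {y z w} → T (N-avoiding y z w) → Edge H x x′ w × w ≢ y × w ≢ z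
  N-avoiding-spec {y} {z} {w} h =
    let Nw , w∉yz = Equivalence.to (T-∧ {N w}) h
        w≉y , w≉z = Equivalence.to (T-∧ {not ⌊ w ≟ y ⌋}) w∉yz
    in Equivalence.to T-≡ Nw , toWitnessFalse w≉y , toWitnessFalse w≉z

  F5-copy : ∀ {y z} → y ≢ z → Edge H x y z → Edge H x′ y z →
    (f : Fin (suc t) → Fin n) → Injective _≡_ _≡_ f → (∀ k → T (N-avoiding y z (f k))) → CopyOfF5 t H
  F5-copy {y} {z} y≢z xyz x′yz f f-inj f-avoids = record
    { φ    = y ∷ z ∷ x ∷ x′ ∷ f
    ; inj  = ∷-injective (∷-injective (∷-injective (∷-injective f-inj f≢x′)
               (∷-avoids (≢-sym x≢x′) f≢x))
               (∷-avoids (edge-≢₁₃ H xyz) (∷-avoids (edge-≢₁₃ H x′yz) f≢z)))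
               (∷-avoids (≢-sym y≢z) (∷-avoids (edge-≢₁₂ H xyz) (∷-avoids (edge-≢₁₂ H x′yz) f≢y)))
    ; e123 = edge-rotate H xyz
    ; e124 = edge-rotate H x′yz
    ; e34k = N-f
    }
    where
    N-f : ∀ k → Edge H x x′ (f k)
    N-f k = proj₁ (N-avoiding-spec (f-avoids k))
    f≢x : ∀ k → f k ≢ x
    f≢x k = ≢-sym (edge-≢₁₃ H (N-f k))
    f≢x′ : ∀ k → f k ≢ x′
    f≢x′ k = ≢-sym (edge-≢₂₃ H (N-f k))
    f≢y : ∀ k → f k ≢ y
    f≢y k = proj₁ (proj₂ (N-avoiding-spec (f-avoids k)))
    f≢z : ∀ k → f k ≢ z
    f≢z k = proj₂ (proj₂ (N-avoiding-spec (f-avoids k)))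

  many-N-avoiding : ∀ y z → t + (𝟙 (N y) + 𝟙 (N z)) < codeg H x x′ →
    suc t ≤ ∑[ w < n ] 𝟙 (N-avoiding y z w)
  many-N-avoiding y z large = +-cancelʳ-≤ (𝟙 (N y) + 𝟙 (N z)) (suc t) _ (≤-trans large (codeg≤N-avoiding y z))

  common-pair⇒codeg≤ : ∀ {y z} → y ≢ z → Edge H x y z → Edge H x′ y z →
    codeg H x x′ ≤ t + (𝟙 (N y) + 𝟙 (N z))
  common-pair⇒codeg≤ {y} {z} y≢z xyz x′yz with codeg H x x′ ≤? t + (𝟙 (N y) + 𝟙 (N z))
  ... | yes small = small
  ... | no large with injection-from-count (N-avoiding y z) (many-N-avoiding y z (≰⇒> large))
  ...   | f , f-inj , f-avoids = ⊥-elim (H-free (F5-copy y≢z xyz x′yz f f-inj f-avoids))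

  T-common⇒codeg≤ : ∀ {y z} → toℕ y < toℕ z → T (common y z) →
    codeg H x x′ ≤ t + (𝟙 (N y) + 𝟙 (N z))
  T-common⇒codeg≤ {y} {z} y<z yz-common =
    let xyz , x′yz = Equivalence.to (T-∧ {edge H x y z}) yz-common
    in common-pair⇒codeg≤ (<⇒≢ y<z) (Equivalence.to T-≡ xyz) (Equivalence.to T-≡ x′yz)

  pairSum-common-≤ : t + 1 ≤ codeg H x x′ → pairSum (λ y z → 𝟙 (common y z)) ≤ (t + 2) * n
  pairSum-common-≤ t<codeg with codeg H x x′ ≤? t + 2
  ... | no large = begin
    pairSum (λ y z → 𝟙 (common y z))
      ≤⟨ pairSum-mono (λ {y} {z} y<z → 𝟙-≤ (λ yz-common → ⊥-elim (large
           (≤-trans (T-common⇒codeg≤ y<z yz-common)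
                    (+-monoʳ-≤ t (+-mono-≤ (𝟙≤1 (N y)) (𝟙≤1 (N z)))))))) ⟩
    pairSum {n} (λ _ _ → 0)
      ≡⟨ pairSum-zero {n} ⟩
    0
      ≤⟨ z≤n ⟩
    (t + 2) * n ∎
    where open ≤-Reasoning
  ... | yes small = begin
    pairSum (λ y z → 𝟙 (common y z))
      ≤⟨ pairSum-mono (λ y<z → 𝟙-≤ (λ yz-common →
           +-cancelˡ-≤ t 1 _ (≤-trans t<codeg (T-common⇒codeg≤ y<z yz-common)))) ⟩
    pairSum (λ y z → 𝟙 (N y) + 𝟙 (N z))
      ≤⟨ pairSum-symmetrised (λ y z → 𝟙 (N y)) ⟩
    ∑[ y < n ] ∑[ z < n ] 𝟙 (N y)
      ≡⟨ sum-cong-≗ {n} (λ y → trans (sum-const n (𝟙 (N y))) (*-comm n (𝟙 (N y)))) ⟩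
    ∑[ y < n ] (𝟙 (N y) * n)
      ≡⟨ *-distribʳ-sum n (λ y → 𝟙 (N y)) ⟨
    ∑[ y < n ] 𝟙 (N y) * n
      ≡⟨ cong (_* n) (listSum-allFin (λ w → 𝟙 (N w))) ⟨
    codeg H x x′ * n
      ≤⟨ *-monoˡ-≤ n small ⟩
    (t + 2) * n ∎
    where open ≤-Reasoning

  dST+dST-≤ : t + 1 ≤ codeg H x x′ → ∀ S T →
    dST H S T x + dST H S T x′ ≤ pairSum (λ y z → 𝟙 (across S T y z)) + (t + 2) * n
  dST+dST-≤ t<codeg S T = begin
    dST H S T x + dST H S T x′
      ≡⟨ cong₂ _+_ (dST≡pairSum H S T x) (dST≡pairSum H S T x′) ⟩
    pairSum (λ y z → 𝟙 (across S T y z ∧ edge H x y z))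
      + pairSum (λ y z → 𝟙 (across S T y z ∧ edge H x′ y z))
      ≡⟨ pairSum-+ (λ y z → 𝟙 (across S T y z ∧ edge H x y z)) _ ⟨
    pairSum (λ y z → 𝟙 (across S T y z ∧ edge H x y z) + 𝟙 (across S T y z ∧ edge H x′ y z))
      ≤⟨ pairSum-mono (λ {y} {z} _ → 𝟙-∧-+-≤ (across S T y z) (edge H x y z) (edge H x′ y z)) ⟩
    pairSum (λ y z → 𝟙 (across S T y z) + 𝟙 (common y z))
      ≡⟨ pairSum-+ (λ y z → 𝟙 (across S T y z)) _ ⟩
    pairSum (λ y z → 𝟙 (across S T y z)) + pairSum (λ y z → 𝟙 (common y z))
      ≤⟨ +-monoʳ-≤ _ (pairSum-common-≤ t<codeg) ⟩
    pairSum (λ y z → 𝟙 (across S T y z)) + (t + 2) * n ∎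
    where open ≤-Reasoning

lemma3p1 : (t n : ℕ) (H : ThreeGraph n) → F5-free t H →
    (x x′ : Fin n) → x ≢ x′ → t + 1 ≤ codeg H x x′ →
    (S T : Subset n) → Disjoint S T →
      (dST H S T x + dST H S T x′ ≤ ∣ S ∣ * ∣ T ∣ + (t + 3) * n)
      × (2 * (dST H S S x + dST H S S x′) ≤ ∣ S ∣ ^ 2 + 2 * ((t + 4) * n))
lemma3p1 t n H H-free x x′ x≢x′ t<codeg S T _ = across-bound , self-bound
  where
  open JointNeighbourhood H H-free x≢x′ using (dST+dST-≤)
  open ≤-Reasoning

  slack : ∀ k → (t + 2) * n ≤ (t + (2 + k)) * n
  slack k = *-monoˡ-≤ n (+-monoʳ-≤ t (m≤m+n 2 k))

  across-bound : dST H S T x + dST H S T x′ ≤ ∣ S ∣ * ∣ T ∣ + (t + 3) * n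
  across-bound = begin
    dST H S T x + dST H S T x′
      ≤⟨ dST+dST-≤ t<codeg S T ⟩
    pairSum (λ y z → 𝟙 (across S T y z)) + (t + 2) * n
      ≤⟨ +-mono-≤ (pairSum-across-≤ S T) (slack 1) ⟩
    ∣ S ∣ * ∣ T ∣ + (t + 3) * n ∎

  self-bound : 2 * (dST H S S x + dST H S S x′) ≤ ∣ S ∣ ^ 2 + 2 * ((t + 4) * n)
  self-bound = begin
    2 * (dST H S S x + dST H S S x′)
      ≤⟨ *-monoʳ-≤ 2 (dST+dST-≤ t<codeg S S) ⟩
    2 * (P + (t + 2) * n)
      ≡⟨ *-distribˡ-+ 2 P ((t + 2) * n) ⟩
    2 * P + 2 * ((t + 2) * n)
      ≤⟨ +-mono-≤ (pairSum-across-self-≤ S) (*-monoʳ-≤ 2 (slack 2)) ⟩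
    ∣ S ∣ ^ 2 + 2 * ((t + 4) * n) ∎
    where
    P : ℕ
    P = pairSum (λ y z → 𝟙 (across S S y z))
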